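{- Let $n,k\ge1$. There is no triple $(l,\mathbf m,\mathbf a)\in\mathcal A(n,k)$ satisfying all of the following: (1A) $l>0$; (2A) if $l<n$, then $\mathrm{PF}_{k,1}$ holds for $\rho(\mathbf m,\mathbf a)$; (1B) $l<n$; (2B) if $l>0$, then $\mathrm{NPF}_{k,n-1}$ holds for $\rho^{ -1}(\mathbf m,\mathbf a)$; (3B) $m_1>0$.
   Context: For $\mathbf m\in\mathbb Z^n$, $\mathbf a\in\mathbb Z_{\ge1}^n$ and $1\le i\le n-1$: $\mathrm{PF}_{k,i}$ holds for $(\mathbf m,\mathbf a)$ if $m_{i+1}\le m_i+k-1$, or $m_{i+1}=m_i+k$ and $a_{i+1}>a_i$; $\mathrm{NPF}_{k,i}$ holds if $m_{i+1}>m_i+k$, or $m_{i+1}=m_i+k$ and $a_{i+1}\le a_i$ (the negation of $\mathrm{PF}_{k,i}$). The rotation $\rho(\mathbf m,\mathbf a)=(\mathbf m',\mathbf a')$ is given by $m'_i=m_{i-1}$, $a'_i=a_{i-1}$ for $2\le i\le n$, $m'_1=m_n+1$, $a'_1=a_n$; $\rho^{ -1}$ is its inverse ($m''_i=m_{i+1}$, $a''_i=a_{i+1}$ for $i<n$, $m''_n=m_1-1$, $a''_n=a_1$). $\mathcal A(n,k)$ is the set of triples $(l,\mathbf m,\mathbf a)$ with $l\in\{0,\dots,n\}$, $\mathbf m\in\mathbb Z_{\ge0}^n$, $\mathbf a\in\mathbb Z_{\ge1}^n$, such that $\mathrm{PF}_{k,i}$ holds for $(\mathbf m,\mathbf a)$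 for $1\le i\le n-l-1$ and $\mathrm{NPF}_{k,i}$ holds for $n-l+1\le i\le n-1$. -}

module Defs where

open import Data.Nat as ℕ using (ℕ; zero; suc; s≤s; z≤n)
open import Data.Nat.Properties using (≤-trans; n≤1+n)
open import Data.Integer as ℤ using (ℤ; +_)
open import Data.Fin using (Fin; fromℕ<; toℕ; zero; suc; inject₁; fromℕ)
open import Data.Product using (_×_; _,_)
open import Data.Sum using (_⊎_)
open import Data.Empty using (⊥)
open import Data.Unit using (⊤)

-- A pair (m , a) with m ∈ ℤⁿ and a ∈ ℤⁿ (a ≥ 1 imposed separately where needed).
-- Sequences are 0-based functions Fin n → ℤ; the paper's m_j is  m (j-1).
Seq : ℕ → Set
Seq n = Fin n → ℤ

PFat : ∀ {n} → ℕ → Seq n → Seq n → Fin n → Fin n → Set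
PFat k m a p q =
  (m q ℤ.≤ (m p ℤ.+ + k) ℤ.- ℤ.1ℤ)
  ⊎ ((m q ≡ m p ℤ.+ + k) × (a p ℤ.< a q))
  where open import Relation.Binary.PropositionalEquality using (_≡_)

NPFat : ∀ {n} → ℕ → Seq n → Seq n → Fin n → Fin n → Set
NPFat k m a p q =
  (m p ℤ.+ + k ℤ.< m q)
  ⊎ ((m q ≡ m p ℤ.+ + k) × (a q ℤ.≤ a p))
  where open import Relation.Binary.PropositionalEquality using (_≡_)

-- PF_{k,i} / NPF_{k,i} with paper (1-based) index i, 1 ≤ i ≤ n-1,
-- i.e. comparing paper entries i and i+1 (0-based positions i-1 and i).
PF : ∀ {n} → ℕ → Seq n → Seq n → (i : ℕ) → 1 ℕ.≤ i → i ℕ.< n → Set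
PF k m a (suc j) _ i<n = PFat k m a (fromℕ< (≤-trans (n≤1+n (suc j)) i<n)) (fromℕ< i<n)

NPF : ∀ {n} → ℕ → Seq n → Seq n → (i : ℕ) → 1 ℕ.≤ i → i ℕ.< n → Set
NPF k m a (suc j) _ i<n = NPFat k m a (fromℕ< (≤-trans (n≤1+n (suc j)) i<n)) (fromℕ< i<n)

ρm : ∀ {n} → Seq (suc n) → Seq (suc n)
ρm m zero = m (fromℕ _) ℤ.+ ℤ.1ℤ
ρm m (suc i) = m (inject₁ i)

ρa : ∀ {n} → Seq (suc n) → Seq (suc n)
ρa a zero = a (fromℕ _)
ρa a (suc i) = a (inject₁ i)

snoc : ∀ {n} → (Fin n → ℤ) → ℤ → Seq (suc n)
snoc {zero} f d zero = d
snoc {suc n} f d zero = f zero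
snoc {suc n} f d (suc i) = snoc (λ j → f (suc j)) d i

ρ⁻¹m : ∀ {n} → Seq (suc n) → Seq (suc n)
ρ⁻¹m m = snoc (λ i → m (suc i)) (m zero ℤ.- ℤ.1ℤ)

ρ⁻¹a : ∀ {n} → Seq (suc n) → Seq (suc n)
ρ⁻¹a a = snoc (λ i → a (suc i)) (a zero)

record InA (n k l : ℕ) (m a : Seq n) : Set where
  field
    l≤n   : l ℕ.≤ n
    m≥0   : ∀ i → ℤ.0ℤ ℤ.≤ m i
    a≥1   : ∀ i → ℤ.1ℤ ℤ.≤ a i
    pfs   : ∀ i (1≤i : 1 ℕ.≤ i) (i<n : i ℕ.< n) → i ℕ.≤ (n ℕ.∸ l) ℕ.∸ 1 → PF k m a i 1≤i i<n
    npfs  : ∀ i (1≤i : 1 ℕ.≤ i) (i<n : i ℕ.< n) → (n ℕ.∸ l) ℕ.+ 1 ℕ.≤ i → NPF k m a i 1≤i i<n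

-- PF_{k,i} and NPF_{k,i} are complementary conditions on the gap m_{i+1} − m_i
-- and on the pair (a_i , a_{i+1}).  Condition (2A) is PF_{k,1} for ρ(m,a), which
-- concerns the gap (m_1) − (m_n + 1); condition (2B) is NPF_{k,n−1} for
-- ρ⁻¹(m,a), which concerns the gap (m_1 − 1) − m_n.  The two gaps coincide, and
-- both conditions compare a_n with a_1, so (2A) and (2B) contradict each other
-- as soon as 0 < l < n makes both of them applicable.
module Submission where

open import Defs
open import Data.Nat using (ℕ; suc; _<_; _≤_; _∸_; s≤s; z≤n)
open import Data.Integer using (ℤ; 0ℤ) renaming (_<_ to _<ℤ_)
open import Data.Fin using (zero)
open import Data.Product using (_×_)
open import Relation.Nullary using (¬_)

import Data.Nat.Properties as ℕ
import Data.Integer as ℤ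
import Data.Integer.Properties as ℤ
open import Data.Integer.Tactic.RingSolver using (solve-∀)
open import Data.Fin using (Fin; fromℕ; fromℕ<; inject₁; suc)
open import Data.Fin.Properties using (toℕ-injective; toℕ-fromℕ; toℕ-fromℕ<; toℕ-inject₁; fromℕ-def)
open import Data.Product using (_,_)
open import Data.Sum using (_⊎_; inj₁; inj₂)
open import Relation.Binary.PropositionalEquality

snoc-fromℕ : ∀ {n} (f : Fin n → ℤ) d → snoc f d (fromℕ n) ≡ d
snoc-fromℕ {ℕ.zero} f d = refl
snoc-fromℕ {suc n}  f d = snoc-fromℕ (λ j → f (suc j)) d

snoc-inject₁ : ∀ {n} (f : Fin n → ℤ) d (i : Fin n) → snoc f d (inject₁ i) ≡ f i
snoc-inject₁ {suc n} f d zero    = refl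
snoc-inject₁ {suc n} f d (suc i) = snoc-inject₁ (λ j → f (suc j)) d i

[u+w]-u≡w : ∀ u w → (u ℤ.+ w) ℤ.- u ≡ w
[u+w]-u≡w = solve-∀

<-+⇒-< : ∀ {u v w} → v ℤ.< u ℤ.+ w → v ℤ.- u ℤ.< w
<-+⇒-< {u} {v} {w} v<u+w =
  subst (v ℤ.- u ℤ.<_) ([u+w]-u≡w u w) (ℤ.+-monoˡ-< (ℤ.- u) v<u+w)

+-<⇒<- : ∀ {u v w} → u ℤ.+ w ℤ.< v → w ℤ.< v ℤ.- u
+-<⇒<- {u} {v} {w} u+w<v =
  subst (ℤ._< v ℤ.- u) ([u+w]-u≡w u w) (ℤ.+-monoˡ-< (ℤ.- u) u+w<v)

≤-1⇒< : ∀ {i j} → i ℤ.≤ j ℤ.- ℤ.1ℤ → i ℤ.< j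
≤-1⇒< {i} {j} i≤j-1 = ℤ.i≤pred[j]⇒i<j (subst (i ℤ.≤_) (ℤ.+-comm j ℤ.-1ℤ) i≤j-1)

gap : ∀ {n} → Seq n → Fin n → Fin n → ℤ
gap m p q = m q ℤ.- m p

PFat⇒gap : ∀ {n} k (m a : Seq n) p q → PFat k m a p q →
           gap m p q ℤ.< ℤ.+ k ⊎ (gap m p q ≡ ℤ.+ k × a p ℤ.< a q)
PFat⇒gap k m a p q (inj₁ le)        = inj₁ (<-+⇒-< (≤-1⇒< le))
PFat⇒gap k m a p q (inj₂ (eq , lt)) = inj₂ (trans (cong (ℤ._- m p) eq) ([u+w]-u≡w (m p) (ℤ.+ k)) , lt)

NPFat⇒gap : ∀ {n} k (m a : Seq n) p q → NPFat k m a p q →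
            ℤ.+ k ℤ.< gap m p q ⊎ (gap m p q ≡ ℤ.+ k × a q ℤ.≤ a p)
NPFat⇒gap k m a p q (inj₁ lt)        = inj₁ (+-<⇒<- lt)
NPFat⇒gap k m a p q (inj₂ (eq , le)) = inj₂ (trans (cong (ℤ._- m p) eq) ([u+w]-u≡w (m p) (ℤ.+ k)) , le)

PFat-NPFat-exclusive :
  ∀ {n n′} k (m a : Seq n) (m′ a′ : Seq n′) p q p′ q′ →
  gap m p q ≡ gap m′ p′ q′ → a p ≡ a′ p′ → a q ≡ a′ q′ →
  PFat k m a p q → ¬ NPFat k m′ a′ p′ q′
PFat-NPFat-exclusive k m a m′ a′ p q p′ q′ g≡g′ ap≡ aq≡ pf npf
  with PFat⇒gap k m a p q pf | NPFat⇒gap k m′ a′ p′ q′ npf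
... | inj₁ g<k          | inj₁ k<g′         = ℤ.<-asym g<k (subst (ℤ.+ k ℤ.<_) (sym g≡g′) k<g′)
... | inj₁ g<k          | inj₂ (g′≡k , _)   = ℤ.<-irrefl (trans g≡g′ g′≡k) g<k
... | inj₂ (g≡k , _)    | inj₁ k<g′         = ℤ.<-irrefl (sym (trans (sym g≡g′) g≡k)) k<g′
... | inj₂ (_ , ap<aq)  | inj₂ (_ , aq′≤ap′) =
  ℤ.<⇒≱ ap<aq (subst₂ ℤ._≤_ (sym aq≡) (sym ap≡) aq′≤ap′)

ρ-gap≡ρ⁻¹-gap : ∀ {n} (m : Seq (suc (suc n))) →
  gap (ρm m) zero (suc zero) ≡ gap (ρ⁻¹m m) (inject₁ (fromℕ n)) (fromℕ (suc n))
ρ-gap≡ρ⁻¹-gap {n} m = begin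
  m zero ℤ.- (m last ℤ.+ ℤ.1ℤ)   ≡⟨ shift-unit (m zero) (m last) ⟩
  (m zero ℤ.- ℤ.1ℤ) ℤ.- m last   ≡⟨ sym (cong₂ ℤ._-_ (snoc-fromℕ tail (m zero ℤ.- ℤ.1ℤ))
                                                      (snoc-inject₁ tail (m zero ℤ.- ℤ.1ℤ) (fromℕ n))) ⟩
  gap (ρ⁻¹m m) (inject₁ (fromℕ n)) (fromℕ (suc n)) ∎
  where
  open ≡-Reasoning
  last : Fin (suc (suc n))
  last = fromℕ (suc n)
  tail : Fin (suc n) → ℤ
  tail i = m (suc i)
  shift-unit : ∀ y x → y ℤ.- (x ℤ.+ ℤ.1ℤ) ≡ (y ℤ.- ℤ.1ℤ) ℤ.- x
  shift-unit = solve-∀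

fromℕ<-pred≡inject₁-fromℕ : ∀ n .(h : n < suc (suc n)) → fromℕ< h ≡ inject₁ (fromℕ n)
fromℕ<-pred≡inject₁-fromℕ n h =
  toℕ-injective (trans (toℕ-fromℕ< h) (sym (trans (toℕ-inject₁ (fromℕ n)) (toℕ-fromℕ n))))

proposition4p15 : ∀ (n′ k : ℕ) → 1 ≤ k → ∀ (l : ℕ) (m a : Seq (suc n′)) →
    ¬ ( InA (suc n′) k l m a
    × 0 < l
    × (l < suc n′ → (h : 1 < suc n′) → PF k (ρm m) (ρa a) 1 (s≤s z≤n) h)
    × l < suc n′
    × (0 < l → (h : suc n′ ∸ 1 < suc n′) (h1 : 1 ≤ suc n′ ∸ 1) → NPF k (ρ⁻¹m m) (ρ⁻¹a a) (suc n′ ∸ 1) h1 h)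
    × 0ℤ <ℤ m zero )
proposition4p15 ℕ.zero k _ l m a (_ , 0<l , _ , l<1 , _) = ℕ.<⇒≱ 0<l (ℕ.≤-pred l<1)
proposition4p15 (suc n) k _ l m a (_ , 0<l , pf , l<n , npf , _) =
  PFat-NPFat-exclusive k (ρm m) (ρa a) (ρ⁻¹m m) (ρ⁻¹a a)
    zero (suc zero) (inject₁ (fromℕ n)) (fromℕ (suc n))
    (ρ-gap≡ρ⁻¹-gap m)
    (sym (snoc-inject₁ (λ i → a (suc i)) (a zero) (fromℕ n)))
    (sym (snoc-fromℕ (λ i → a (suc i)) (a zero)))
    (pf l<n (s≤s (s≤s z≤n)))
    (subst₂ (NPFat k (ρ⁻¹m m) (ρ⁻¹a a)) (fromℕ<-pred≡inject₁-fromℕ n _) (sym (fromℕ-def (suc n)))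
      (npf 0<l (ℕ.n<1+n (suc n)) (s≤s z≤n)))
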